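{- Let $X$ be a finite connected pure $2$-dimensional simplicial complex with vertex set $V$, and let $G_V$ be the $1$-skeleton of $X$, regarded as a graph. If $A$ is a nonempty proper subset of $V$ attaining the minimum \[H(X)=\min_{0 < |A|<|V|} \frac{|V|\cdot |F(A,V\setminus A)|}{|A|\cdot |V\setminus A|},\] then the subgraph of $G_V$ induced by $A$ is connected.
   Context: A simplicial complex is pure if all its inclusion-maximal faces have the same dimension. For a $2$-dimensional complex $X$ with vertex set $V$ and $A\subset V$, $F(A,V\setminus A)$ denotes the set of $2$-faces of $X$ containing at least one vertex of $A$ and at least one vertex of $V\setminus A$; the minimum is over nonempty proper subsets $A$ of $V$. The subgraph induced by $A$ has vertex set $A$ and contains exactly those edges of $G_V$ with both endpoints in $A$. -}

module Defs where

open import Data.Nat using (ℕ; zero; suc; _*_; _≤_; _≟_)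
open import Data.Bool using (true; false)
open import Data.Vec using (_∷_; [])
open import Data.List using (List; []; _++_; map; filter; length)
open import Data.Fin using (Fin)
open import Data.Fin.Subset using (Subset; ⁅_⁆; _∈_; _⊆_; _∩_; _∪_; ∁; ∣_∣; Nonempty)
open import Data.Fin.Subset.Properties using (nonempty?)
open import Data.Product using (Σ; _×_; ∃)
open import Relation.Nullary using (¬_)
open import Relation.Nullary.Decidable using (_×-dec_)
open import Relation.Unary using (Decidable)
open import Relation.Binary.PropositionalEquality using (_≡_)
open import Relation.Binary.Construct.Closure.ReflexiveTransitive using (Star)

record SimplicialComplex (n : ℕ) : Set₁ where
  field
    IsFace      : Subset n → Set
    isFace?     : Decidable IsFace
    downClosed  : ∀ {σ τ} → τ ⊆ σ → IsFace σ → IsFace τ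
    vertexFaces : ∀ (v : Fin n) → IsFace ⁅ v ⁆

module _ {n : ℕ} (X : SimplicialComplex n) where
  open SimplicialComplex X

  MaximalFace : Subset n → Set
  MaximalFace σ = IsFace σ × (∀ τ → IsFace τ → σ ⊆ τ → τ ≡ σ)

  IsPure2Dim : Set
  IsPure2Dim =
    (∀ σ → IsFace σ → ∣ σ ∣ ≤ 3) ×
    (∃ λ σ → IsFace σ × ∣ σ ∣ ≡ 3) ×
    (∀ σ → MaximalFace σ → ∣ σ ∣ ≡ 3)

  Adj : Fin n → Fin n → Set
  Adj u v = ¬ (u ≡ v) × IsFace (⁅ u ⁆ ∪ ⁅ v ⁆)

  IsConnected : Set
  IsConnected = ∀ u v → Star Adj u v

  InducedAdj : Subset n → Fin n → Fin n → Set
  InducedAdj A u v = u ∈ A × v ∈ A × Adj u v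

  InducedConnected : Subset n → Set
  InducedConnected A = ∀ u v → u ∈ A → v ∈ A → Star (InducedAdj A) u v

allSubsets : (n : ℕ) → List (Subset n)
allSubsets zero = [] Data.List.∷ []
allSubsets (suc n) = map (true ∷_) (allSubsets n) ++ map (false ∷_) (allSubsets n)

module _ {n : ℕ} (X : SimplicialComplex n) where
  open SimplicialComplex X

  -- σ ∈ F(A, V ∖ A): σ is a 2-face meeting both A and V ∖ A
  Crossing : Subset n → Subset n → Set
  Crossing A σ = IsFace σ × ∣ σ ∣ ≡ 3 × Nonempty (σ ∩ A) × Nonempty (σ ∩ ∁ A)

  crossing? : (A : Subset n) → Decidable (Crossing A)
  crossing? A σ = isFace? σ ×-dec ((∣ σ ∣ ≟ 3) ×-dec (nonempty? (σ ∩ A) ×-dec nonempty? (σ ∩ ∁ A)))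

  numF : Subset n → ℕ
  numF A = length (filter (crossing? A) (allSubsets n))

  NonemptyProper : Subset n → Set
  NonemptyProper A = Nonempty A × Nonempty (∁ A)

  -- A attains the minimum of |V|·|F(A,V∖A)| / (|A|·|V∖A|) over nonempty
  -- proper subsets (comparison of fractions with positive denominators,
  -- done by cross-multiplication)
  AttainsH : Subset n → Set
  AttainsH A = NonemptyProper A ×
    (∀ B → NonemptyProper B →
       (n * numF A) * (∣ B ∣ * ∣ ∁ B ∣) ≤ (n * numF B) * (∣ A ∣ * ∣ ∁ A ∣))

{-# OPTIONS --safe #-}
-- Suppose the subgraph induced by A is disconnected: let B be the component of a vertex of A
-- and C = A ∖ B. No triangle meets both B and C, so F(A) is the disjoint union of F(B) and
-- F(C). With a = |B|, b = |C| and c = |V ∖ A|, minimality of A against B and against C gives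
--   |F(A)| a (b + c) ≤ |F(B)| (a + b) c   and   |F(A)| b (a + c) ≤ |F(C)| (a + b) c,
-- and adding these yields 2 |F(A)| a b ≤ 0, so F(A) is empty. But in a connected complex
-- some edge leaves A, and in a pure 2-dimensional one that edge lies in a triangle of F(A).
module Submission where

open import Level using (Level)
open import Defs
open import Data.Nat using (ℕ; zero; suc; _+_; _*_; _≤_; _<_; s≤s; NonZero; >-nonZero)
open import Data.Nat.Properties
open import Data.Nat.Tactic.RingSolver using (solve-∀)
open import Data.Bool using (true; false)
open import Data.Vec using (_∷_; []; here)
open import Data.List using ([]; _∷_; map; filter; length)
open import Data.List.Properties using (filter-accept; filter-reject)
open import Data.List.Membership.Propositional using () renaming (_∈_ to _∈ₗ_)
open import Data.List.Membership.Propositional.Properties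
  using (∈-++⁺ˡ; ∈-++⁺ʳ; ∈-map⁺; ∈-filter⁺; ∈-length)
open import Data.List.Relation.Unary.Any using (here)
open import Data.Fin using (Fin)
open import Data.Fin.Properties using (any?; nonZeroIndex) renaming (_≟_ to _≟ᶠ_)
open import Data.Fin.Subset using (Subset; ⁅_⁆; _∈_; _∉_; _⊆_; _⊂_; _∩_; _∪_; ∁; ∣_∣; Nonempty)
open import Data.Fin.Subset.Properties
open import Data.Product using (_×_; ∃; ∃₂; _,_; proj₁; proj₂)
open import Data.Sum using (_⊎_; inj₁; inj₂; [_,_])
open import Data.Empty using (⊥; ⊥-elim)
open import Function using (_∘_)
open import Relation.Nullary using (¬_; Dec; yes; no; ¬?)
open import Relation.Nullary.Decidable using (_×-dec_)
open import Relation.Unary using (Pred; Decidable)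
open import Relation.Binary using (Rel)
open import Relation.Binary.PropositionalEquality
  using (_≡_; refl; sym; trans; cong; cong₂; subst; subst₂; module ≡-Reasoning)
open import Relation.Binary.Construct.Closure.ReflexiveTransitive using (Star; ε; _◅_; _◅◅_)

private
  variable
    n : ℕ
    ℓ : Level
    p q r : Subset n
    x y : Fin n

x∈p⇒⁅x⁆⊆p : x ∈ p → ⁅ x ⁆ ⊆ p
x∈p⇒⁅x⁆⊆p {x = x} {p = p} x∈p z∈⁅x⁆ = subst (_∈ p) (sym (x∈⁅y⁆⇒x≡y x z∈⁅x⁆)) x∈p

∪-least : p ⊆ r → q ⊆ r → p ∪ q ⊆ r
∪-least {p = p} {q = q} p⊆r q⊆r z∈p∪q = [ p⊆r , q⊆r ] (x∈p∪q⁻ p q z∈p∪q)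

nonempty⇒∣p∣>0 : Nonempty p → 0 < ∣ p ∣
nonempty⇒∣p∣>0 {p = p} (x , x∈p) = subst (_≤ ∣ p ∣) (∣⁅x⁆∣≡1 x) (p⊆q⇒∣p∣≤∣q∣ (x∈p⇒⁅x⁆⊆p x∈p))

∣p∪q∣≤∣p∣+∣q∣ : ∀ (p q : Subset n) → ∣ p ∪ q ∣ ≤ ∣ p ∣ + ∣ q ∣
∣p∪q∣≤∣p∣+∣q∣ [] [] = ≤-refl
∣p∪q∣≤∣p∣+∣q∣ (true ∷ p) (true ∷ q) = s≤s (≤-trans (∣p∪q∣≤∣p∣+∣q∣ p q) (+-monoʳ-≤ ∣ p ∣ (n≤1+n _)))
∣p∪q∣≤∣p∣+∣q∣ (true ∷ p) (false ∷ q) = s≤s (∣p∪q∣≤∣p∣+∣q∣ p q)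
∣p∪q∣≤∣p∣+∣q∣ (false ∷ p) (true ∷ q) =
  subst (suc ∣ p ∪ q ∣ ≤_) (sym (+-suc _ _)) (s≤s (∣p∪q∣≤∣p∣+∣q∣ p q))
∣p∪q∣≤∣p∣+∣q∣ (false ∷ p) (false ∷ q) = ∣p∪q∣≤∣p∣+∣q∣ p q

∣p∣+∣∁p∣≡n : ∀ (p : Subset n) → ∣ p ∣ + ∣ ∁ p ∣ ≡ n
∣p∣+∣∁p∣≡n p = trans (cong (∣ p ∣ +_) (∣∁p∣≡n∸∣p∣ p)) (m+[n∸m]≡n (∣p∣≤n p))

p⊆q⇒∣p∣+∣q∩∁p∣≡∣q∣ : p ⊆ q → ∣ p ∣ + ∣ q ∩ ∁ p ∣ ≡ ∣ q ∣
p⊆q⇒∣p∣+∣q∩∁p∣≡∣q∣ {p = []}        {[]}        p⊆q = refl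
p⊆q⇒∣p∣+∣q∩∁p∣≡∣q∣ {p = false ∷ p} {false ∷ q} p⊆q = p⊆q⇒∣p∣+∣q∩∁p∣≡∣q∣ (drop-∷-⊆ p⊆q)
p⊆q⇒∣p∣+∣q∩∁p∣≡∣q∣ {p = false ∷ p} {true ∷ q}  p⊆q =
  trans (+-suc _ _) (cong suc (p⊆q⇒∣p∣+∣q∩∁p∣≡∣q∣ (drop-∷-⊆ p⊆q)))
p⊆q⇒∣p∣+∣q∩∁p∣≡∣q∣ {p = true ∷ p}  {false ∷ q} p⊆q with () ← p⊆q here
p⊆q⇒∣p∣+∣q∩∁p∣≡∣q∣ {p = true ∷ p}  {true ∷ q}  p⊆q = cong suc (p⊆q⇒∣p∣+∣q∩∁p∣≡∣q∣ (drop-∷-⊆ p⊆q))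

∣p∣+∣q∣≡∣r∣⇒∣∁p∣≡∣q∣+∣∁r∣ : ∀ {n} {p q r : Subset n} →
                           ∣ p ∣ + ∣ q ∣ ≡ ∣ r ∣ → ∣ ∁ p ∣ ≡ ∣ q ∣ + ∣ ∁ r ∣
∣p∣+∣q∣≡∣r∣⇒∣∁p∣≡∣q∣+∣∁r∣ {n} {p} {q} {r} eq = +-cancelˡ-≡ ∣ p ∣ _ _ (begin
  ∣ p ∣ + ∣ ∁ p ∣           ≡⟨ ∣p∣+∣∁p∣≡n p ⟩
  n                         ≡⟨ sym (∣p∣+∣∁p∣≡n r) ⟩
  ∣ r ∣ + ∣ ∁ r ∣           ≡⟨ cong (_+ ∣ ∁ r ∣) (sym eq) ⟩
  ∣ p ∣ + ∣ q ∣ + ∣ ∁ r ∣   ≡⟨ +-assoc ∣ p ∣ _ _ ⟩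
  ∣ p ∣ + (∣ q ∣ + ∣ ∁ r ∣) ∎)
  where open ≡-Reasoning

allSubsets-complete : ∀ (p : Subset n) → p ∈ₗ allSubsets n
allSubsets-complete [] = here refl
allSubsets-complete {suc n} (true ∷ p) = ∈-++⁺ˡ (∈-map⁺ (true ∷_) (allSubsets-complete p))
allSubsets-complete {suc n} (false ∷ p) =
  ∈-++⁺ʳ (map (true ∷_) (allSubsets n)) (∈-map⁺ (false ∷_) (allSubsets-complete p))

module _ {a} {A : Set a} {P Q R : Pred A ℓ} (P? : Decidable P) (Q? : Decidable Q) (R? : Decidable R)
         (P⇒Q⊎R : ∀ {x} → P x → Q x ⊎ R x) (Q⇒P : ∀ {x} → Q x → P x) (R⇒P : ∀ {x} → R x → P x)
         (Q-R-disjoint : ∀ {x} → Q x → R x → ⊥) where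

  length-filter-⊎ : ∀ xs → length (filter P? xs) ≡ length (filter Q? xs) + length (filter R? xs)
  length-filter-⊎ [] = refl
  length-filter-⊎ (x ∷ xs) with Q? x | R? x
  ... | yes qx | yes rx = ⊥-elim (Q-R-disjoint qx rx)
  ... | yes qx | no _ =
    trans (cong length (filter-accept P? (Q⇒P qx))) (cong suc (length-filter-⊎ xs))
  ... | no _ | yes rx =
    trans (cong length (filter-accept P? (R⇒P rx)))
          (trans (cong suc (length-filter-⊎ xs)) (sym (+-suc _ _)))
  ... | no ¬qx | no ¬rx =
    trans (cong length (filter-reject P? ([ ¬qx , ¬rx ] ∘ P⇒Q⊎R))) (length-filter-⊎ xs)

Escape : Rel (Fin n) ℓ → Subset n → Set ℓ
Escape R S = ∃₂ λ x y → x ∈ S × y ∉ S × R x y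

star⇒escape : {R : Rel (Fin n) ℓ} {a b : Fin n} → a ∈ p → b ∉ p → Star R a b → Escape R p
star⇒escape a∈p b∉p ε = ⊥-elim (b∉p a∈p)
star⇒escape {p = p} {a = a} a∈p b∉p (_◅_ {j = m} r path) with m ∈? p
... | yes m∈p = star⇒escape m∈p b∉p path
... | no m∉p = a , m , a∈p , m∉p , r

record Component (R : Rel (Fin n) ℓ) (u : Fin n) : Set ℓ where
  field
    members   : Subset n
    source∈   : u ∈ members
    reachable : ∀ {w} → w ∈ members → Star R u w
    closed    : ∀ {x y} → x ∈ members → R x y → y ∈ members

module _ {R : Rel (Fin n) ℓ} (R? : ∀ x y → Dec (R x y)) (u : Fin n) where

  escape? : ∀ S → Dec (Escape R S)
  escape? S = any? λ x → any? λ y → x ∈? S ×-dec ¬? (y ∈? S) ×-dec R? x y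

  private
    Reachable : Subset n → Set ℓ
    Reachable S = ∀ {w} → w ∈ S → Star R u w

    finished : ∀ {S} → ¬ Escape R S → u ∈ S → Reachable S → Component R u
    finished {S} ¬esc u∈S reach = record
      { members = S ; source∈ = u∈S ; reachable = reach ; closed = closed }
      where
      closed : ∀ {x y} → x ∈ S → R x y → y ∈ S
      closed {x} {y} x∈S r with y ∈? S
      ... | yes y∈S = y∈S
      ... | no y∉S = ⊥-elim (¬esc (x , y , x∈S , y∉S , r))

    extend : ∀ {S x y} → Reachable S → x ∈ S → R x y → Reachable (S ∪ ⁅ y ⁆)
    extend {S} {x} {y} reach x∈S r w∈ with x∈p∪q⁻ S ⁅ y ⁆ w∈
    ... | inj₁ w∈S = reach w∈S
    ... | inj₂ w∈⁅y⁆ rewrite x∈⁅y⁆⇒x≡y y w∈⁅y⁆ = reach x∈S ◅◅ (r ◅ ε)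

    -- The fuel k bounds the number of vertices still missing from S.
    grow : ∀ k S → n ≤ ∣ S ∣ + k → u ∈ S → Reachable S → Component R u
    grow k S bound u∈S reach with escape? S
    ... | no ¬esc = finished ¬esc u∈S reach
    grow zero S bound u∈S reach | yes (_ , y , _ , y∉S , _) =
      ⊥-elim (y∉S (subst (y ∈_) (sym (∣p∣≡n⇒p≡⊤ full)) ∈⊤))
      where
      full : ∣ S ∣ ≡ n
      full = ≤-antisym (∣p∣≤n S) (subst (n ≤_) (+-identityʳ _) bound)
    grow (suc k) S bound u∈S reach | yes (x , y , x∈S , y∉S , r) =
      grow k (S ∪ ⁅ y ⁆) bound′ (p⊆p∪q _ u∈S) (extend reach x∈S r)
      where
      S⊂S∪⁅y⁆ : S ⊂ S ∪ ⁅ y ⁆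
      S⊂S∪⁅y⁆ = p⊆p∪q _ , y , q⊆p∪q S _ (x∈⁅x⁆ y) , y∉S
      bound′ : n ≤ ∣ S ∪ ⁅ y ⁆ ∣ + k
      bound′ = ≤-trans bound (≤-trans (≤-reflexive (+-suc _ k)) (+-monoˡ-≤ k (p⊂q⇒∣p∣<∣q∣ S⊂S∪⁅y⁆)))

  component : Component R u
  component = grow n ⁅ u ⁆ (m≤n+m n _) (x∈⁅x⁆ u)
    λ w∈⁅u⁆ → subst (Star R u) (sym (x∈⁅y⁆⇒x≡y u w∈⁅u⁆)) ε

cut-inequalities⇒f₁+f₂≡0 : ∀ k f₁ f₂ a₁ a₂ c →
  .{{k≢0 : NonZero k}} .{{_ : NonZero a₁}} .{{_ : NonZero a₂}} →
  k * (f₁ + f₂) * (a₁ * (a₂ + c)) ≤ k * f₁ * ((a₁ + a₂) * c) →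
  k * (f₁ + f₂) * (a₂ * (a₁ + c)) ≤ k * f₂ * ((a₁ + a₂) * c) →
  f₁ + f₂ ≡ 0
cut-inequalities⇒f₁+f₂≡0 k f₁ f₂ a₁ a₂ c {{k≢0}} h₁ h₂ =
  m*n≡0⇒m≡0 (f₁ + f₂) (k * (a₁ * a₂)) {{m*n≢0 k (a₁ * a₂) {{k≢0}} {{m*n≢0 a₁ a₂}}}}
    (m+n≡0⇒m≡0 K (n≤0⇒n≡0 (+-cancelˡ-≤ R (K + K) 0 R+2K≤R+0)))
  where
  K = (f₁ + f₂) * (k * (a₁ * a₂))
  R = k * f₁ * ((a₁ + a₂) * c) + k * f₂ * ((a₁ + a₂) * c)
  sum-identity : ∀ k f₁ f₂ a₁ a₂ c →
    k * (f₁ + f₂) * (a₁ * (a₂ + c)) + k * (f₁ + f₂) * (a₂ * (a₁ + c)) ≡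
    (k * f₁ * ((a₁ + a₂) * c) + k * f₂ * ((a₁ + a₂) * c)) +
    ((f₁ + f₂) * (k * (a₁ * a₂)) + (f₁ + f₂) * (k * (a₁ * a₂)))
  sum-identity = solve-∀
  R+2K≤R+0 : R + (K + K) ≤ R + 0
  R+2K≤R+0 = subst₂ _≤_ (sum-identity k f₁ f₂ a₁ a₂ c) (sym (+-identityʳ R)) (+-mono-≤ h₁ h₂)

module _ (X : SimplicialComplex n) where
  open SimplicialComplex X

  adj? : ∀ x y → Dec (Adj X x y)
  adj? x y = ¬? (x ≟ᶠ y) ×-dec isFace? (⁅ x ⁆ ∪ ⁅ y ⁆)

  inducedAdj? : ∀ A x y → Dec (InducedAdj X A x y)
  inducedAdj? A x y = x ∈? A ×-dec y ∈? A ×-dec adj? x y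

  induced-star-⊆ : ∀ {A u w} → u ∈ A → Star (InducedAdj X A) u w → w ∈ A
  induced-star-⊆ u∈A ε = u∈A
  induced-star-⊆ u∈A (r ◅ path) = induced-star-⊆ (proj₁ (proj₂ r)) path

  extensible⊎maximal : ∀ {σ} → IsFace σ → (∃ λ w → w ∉ σ × IsFace (σ ∪ ⁅ w ⁆)) ⊎ MaximalFace X σ
  extensible⊎maximal {σ} σ-face with any? (λ w → ¬? (w ∈? σ) ×-dec isFace? (σ ∪ ⁅ w ⁆))
  ... | yes extension = inj₁ extension
  ... | no ¬extension = inj₂ (σ-face , λ τ τ-face σ⊆τ → ⊆-antisym (τ⊆σ τ-face σ⊆τ) σ⊆τ)
    where
    τ⊆σ : ∀ {τ} → IsFace τ → σ ⊆ τ → τ ⊆ σ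
    τ⊆σ τ-face σ⊆τ {z} z∈τ with z ∈? σ
    ... | yes z∈σ = z∈σ
    ... | no z∉σ =
      ⊥-elim (¬extension (z , z∉σ , downClosed (∪-least σ⊆τ (x∈p⇒⁅x⁆⊆p z∈τ)) τ-face))

  edge⊆triangle : IsPure2Dim X → Adj X x y → ∃ λ σ → IsFace σ × ∣ σ ∣ ≡ 3 × x ∈ σ × y ∈ σ
  edge⊆triangle {x = x} {y = y} (dim≤2 , _ , pure) (x≢y , e-face) =
    [ triangle , ⊥-elim ∘ ¬maximal ] (extensible⊎maximal e-face)
    where
    e = ⁅ x ⁆ ∪ ⁅ y ⁆
    x∈e : x ∈ e
    x∈e = p⊆p∪q _ (x∈⁅x⁆ x)
    y∈e : y ∈ e
    y∈e = q⊆p∪q _ _ (x∈⁅x⁆ y)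

    triangle : (∃ λ w → w ∉ e × IsFace (e ∪ ⁅ w ⁆)) → ∃ λ σ → IsFace σ × ∣ σ ∣ ≡ 3 × x ∈ σ × y ∈ σ
    triangle (w , w∉e , σ-face) =
      e ∪ ⁅ w ⁆ , σ-face , ≤-antisym (dim≤2 _ σ-face) 3≤∣σ∣ , p⊆p∪q _ x∈e , p⊆p∪q _ y∈e
      where
      ⁅x⁆⊂e : ⁅ x ⁆ ⊂ e
      ⁅x⁆⊂e = p⊆p∪q _ , y , y∈e , x≢y ∘ sym ∘ x∈⁅y⁆⇒x≡y x
      e⊂σ : e ⊂ e ∪ ⁅ w ⁆
      e⊂σ = p⊆p∪q _ , w , q⊆p∪q _ _ (x∈⁅x⁆ w) , w∉e
      3≤∣σ∣ : 3 ≤ ∣ e ∪ ⁅ w ⁆ ∣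
      3≤∣σ∣ = ≤-trans (s≤s (subst (_< ∣ e ∣) (∣⁅x⁆∣≡1 x) (p⊂q⇒∣p∣<∣q∣ ⁅x⁆⊂e))) (p⊂q⇒∣p∣<∣q∣ e⊂σ)

    ¬maximal : ¬ MaximalFace X e
    ¬maximal e-maximal = 1+n≰n (subst (_≤ 2) (pure e e-maximal) ∣e∣≤2)
      where
      ∣e∣≤2 : ∣ e ∣ ≤ 2
      ∣e∣≤2 = subst (∣ e ∣ ≤_) (cong₂ _+_ (∣⁅x⁆∣≡1 x) (∣⁅x⁆∣≡1 y)) (∣p∪q∣≤∣p∣+∣q∣ ⁅ x ⁆ ⁅ y ⁆)

  crossing-exists : IsPure2Dim X → IsConnected X → ∀ {A} → NonemptyProper X A → ∃ (Crossing X A)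
  crossing-exists pure2 connected {A} ((a , a∈A) , (b , b∈∁A))
    with star⇒escape a∈A (x∈∁p⇒x∉p b∈∁A) (connected a b)
  ... | x , y , x∈A , y∉A , x~y with edge⊆triangle pure2 x~y
  ...   | σ , σ-face , ∣σ∣≡3 , x∈σ , y∈σ =
    σ , σ-face , ∣σ∣≡3 , (x , x∈p∩q⁺ (x∈σ , x∈A)) , (y , x∈p∩q⁺ (y∈σ , x∉p⇒x∈∁p y∉A))

  numF>0 : ∀ {A σ} → Crossing X A σ → 0 < numF X A
  numF>0 {A} {σ} crossing = ∈-length (∈-filter⁺ (crossing? X A) (allSubsets-complete σ) crossing)

module _ (X : SimplicialComplex n) where
  open SimplicialComplex X

  Separated : Subset n → Subset n → Set
  Separated B C = ∀ {σ x y} → IsFace σ → x ∈ σ → y ∈ σ → x ∈ B → y ∈ C → ⊥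

  closed⇒separated : ∀ {A B} → B ⊆ A → (∀ {x y} → x ∈ B → InducedAdj X A x y → y ∈ B) →
                     Separated B (A ∩ ∁ B)
  closed⇒separated {A} {B} B⊆A closed {σ} {x} {y} σ-face x∈σ y∈σ x∈B y∈C =
    x∈∁p⇒x∉p y∈∁B (closed x∈B (B⊆A x∈B , y∈A , x≢y , downClosed ⁅x⁆∪⁅y⁆⊆σ σ-face))
    where
    y∈A : y ∈ A
    y∈A = proj₁ (x∈p∩q⁻ A (∁ B) y∈C)
    y∈∁B : y ∈ ∁ B
    y∈∁B = proj₂ (x∈p∩q⁻ A (∁ B) y∈C)
    ⁅x⁆∪⁅y⁆⊆σ : ⁅ x ⁆ ∪ ⁅ y ⁆ ⊆ σ
    ⁅x⁆∪⁅y⁆⊆σ = ∪-least (x∈p⇒⁅x⁆⊆p x∈σ) (x∈p⇒⁅x⁆⊆p y∈σ)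
    x≢y : ¬ x ≡ y
    x≢y refl = x∈∁p⇒x∉p y∈∁B x∈B

  numF-split : ∀ {A B} → B ⊆ A → Separated B (A ∩ ∁ B) →
               numF X A ≡ numF X B + numF X (A ∩ ∁ B)
  numF-split {A} {B} B⊆A separated =
    length-filter-⊎ (crossing? X A) (crossing? X B) (crossing? X C)
                    split fromB fromC disjoint (allSubsets n)
    where
    C = A ∩ ∁ B
    ∈C : ∀ {z} → z ∈ A → z ∉ B → z ∈ C
    ∈C z∈A z∉B = x∈p∩q⁺ (z∈A , x∉p⇒x∈∁p z∉B)
    C⊆A : C ⊆ A
    C⊆A = proj₁ ∘ x∈p∩q⁻ A (∁ B)
    ∉A : ∀ {z} → z ∉ B → z ∉ C → z ∉ A
    ∉A z∉B z∉C z∈A = z∉C (∈C z∈A z∉B)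

    split : ∀ {σ} → Crossing X A σ → Crossing X B σ ⊎ Crossing X C σ
    split {σ} (σ-face , ∣σ∣≡3 , (x , x∈σ∩A) , (y , y∈σ∩∁A))
      with x∈p∩q⁻ σ A x∈σ∩A | x∈p∩q⁻ σ (∁ A) y∈σ∩∁A | x ∈? B
    ... | x∈σ , x∈A | y∈σ , y∈∁A | yes x∈B = inj₁ (σ-face , ∣σ∣≡3 ,
      (x , x∈p∩q⁺ (x∈σ , x∈B)) , (y , x∈p∩q⁺ (y∈σ , x∉p⇒x∈∁p (x∈∁p⇒x∉p y∈∁A ∘ B⊆A))))
    ... | x∈σ , x∈A | y∈σ , y∈∁A | no x∉B = inj₂ (σ-face , ∣σ∣≡3 ,
      (x , x∈p∩q⁺ (x∈σ , ∈C x∈A x∉B)) , (y , x∈p∩q⁺ (y∈σ , x∉p⇒x∈∁p (x∈∁p⇒x∉p y∈∁A ∘ C⊆A))))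

    fromB : ∀ {σ} → Crossing X B σ → Crossing X A σ
    fromB {σ} (σ-face , ∣σ∣≡3 , (x , x∈σ∩B) , (y , y∈σ∩∁B))
      with x∈p∩q⁻ σ B x∈σ∩B | x∈p∩q⁻ σ (∁ B) y∈σ∩∁B
    ... | x∈σ , x∈B | y∈σ , y∈∁B = σ-face , ∣σ∣≡3 , (x , x∈p∩q⁺ (x∈σ , B⊆A x∈B)) ,
      (y , x∈p∩q⁺ (y∈σ , x∉p⇒x∈∁p (∉A (x∈∁p⇒x∉p y∈∁B) (separated σ-face x∈σ y∈σ x∈B))))

    fromC : ∀ {σ} → Crossing X C σ → Crossing X A σ
    fromC {σ} (σ-face , ∣σ∣≡3 , (x , x∈σ∩C) , (y , y∈σ∩∁C))
      with x∈p∩q⁻ σ C x∈σ∩C | x∈p∩q⁻ σ (∁ C) y∈σ∩∁C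
    ... | x∈σ , x∈C | y∈σ , y∈∁C = σ-face , ∣σ∣≡3 , (x , x∈p∩q⁺ (x∈σ , C⊆A x∈C)) ,
      (y , x∈p∩q⁺ (y∈σ , x∉p⇒x∈∁p (∉A (λ y∈B → separated σ-face y∈σ x∈σ y∈B x∈C) (x∈∁p⇒x∉p y∈∁C))))

    disjoint : ∀ {σ} → Crossing X B σ → Crossing X C σ → ⊥
    disjoint {σ} (σ-face , _ , (x , x∈σ∩B) , _) (_ , _ , (y , y∈σ∩C) , _) =
      separated σ-face (proj₁ (x∈p∩q⁻ σ B x∈σ∩B)) (proj₁ (x∈p∩q⁻ σ C y∈σ∩C))
                       (proj₂ (x∈p∩q⁻ σ B x∈σ∩B)) (proj₂ (x∈p∩q⁻ σ C y∈σ∩C))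

  split-cut⇒numF≡0 : ∀ {A B} → AttainsH X A → B ⊆ A → Separated B (A ∩ ∁ B) →
                     Nonempty B → Nonempty (A ∩ ∁ B) → numF X A ≡ 0
  split-cut⇒numF≡0 {A} {B} (_ , minimal) B⊆A separated B≠∅@(u , u∈B) C≠∅@(v , v∈C) =
    trans (numF-split B⊆A separated)
      (cut-inequalities⇒f₁+f₂≡0 n (numF X B) (numF X C) (∣ B ∣) (∣ C ∣) (∣ ∁ A ∣)
         {{nonZeroIndex u}} {{>-nonZero (nonempty⇒∣p∣>0 B≠∅)}} {{>-nonZero (nonempty⇒∣p∣>0 C≠∅)}}
         (against B C (B≠∅ , v , x∉p⇒x∈∁p v∉B) ∣B∣+∣C∣≡∣A∣)
         (against C B (C≠∅ , u , x∉p⇒x∈∁p u∉C) (trans (+-comm (∣ C ∣) (∣ B ∣)) ∣B∣+∣C∣≡∣A∣)))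
    where
    C = A ∩ ∁ B
    v∉B : v ∉ B
    v∉B = x∈∁p⇒x∉p (proj₂ (x∈p∩q⁻ A (∁ B) v∈C))
    u∉C : u ∉ C
    u∉C u∈C = x∈∁p⇒x∉p (proj₂ (x∈p∩q⁻ A (∁ B) u∈C)) u∈B
    ∣B∣+∣C∣≡∣A∣ : ∣ B ∣ + ∣ C ∣ ≡ ∣ A ∣
    ∣B∣+∣C∣≡∣A∣ = p⊆q⇒∣p∣+∣q∩∁p∣≡∣q∣ B⊆A
    against : ∀ P Q → NonemptyProper X P → ∣ P ∣ + ∣ Q ∣ ≡ ∣ A ∣ →
              n * (numF X B + numF X C) * (∣ P ∣ * (∣ Q ∣ + ∣ ∁ A ∣)) ≤
              n * numF X P * ((∣ B ∣ + ∣ C ∣) * ∣ ∁ A ∣)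
    against P Q P-proper ∣P∣+∣Q∣≡∣A∣ = subst₂ _≤_
      (cong₂ (λ f m → n * f * (∣ P ∣ * m))
             (numF-split B⊆A separated) (∣p∣+∣q∣≡∣r∣⇒∣∁p∣≡∣q∣+∣∁r∣ {p = P} {Q} {A} ∣P∣+∣Q∣≡∣A∣))
      (cong (λ a → n * numF X P * (a * ∣ ∁ A ∣)) (sym ∣B∣+∣C∣≡∣A∣))
      (minimal P P-proper)

lemma3p1 : (n : ℕ) (X : SimplicialComplex n) →
           IsPure2Dim X → IsConnected X →
           (A : Subset n) → AttainsH X A →
           InducedConnected X A
lemma3p1 n X pure2 connected A attainsH@(A-proper , _) u v u∈A v∈A = reach-or-split (v ∈? B)
  where
  open Component (component (inducedAdj? X A) u) renaming (members to B)

  B⊆A : B ⊆ A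
  B⊆A = induced-star-⊆ X u∈A ∘ reachable

  reach-or-split : Dec (v ∈ B) → Star (InducedAdj X A) u v
  reach-or-split (yes v∈B) = reachable v∈B
  reach-or-split (no v∉B) with crossing-exists X pure2 connected A-proper
  ... | _ , crossing = ⊥-elim (<⇒≢ (numF>0 X crossing) (sym numF≡0))
    where
    numF≡0 : numF X A ≡ 0
    numF≡0 = split-cut⇒numF≡0 X attainsH B⊆A (closed⇒separated X B⊆A closed)
               (u , source∈) (v , x∈p∩q⁺ (v∈A , x∉p⇒x∈∁p v∉B))
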